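{- Let $P$ be a connected finite $\Gamma$-colored minuscule poset and assume $\Gamma$ is simply laced. If $P$ is a chain, then $P$ has type $A$ standard, i.e. $P$ is isomorphic, as a colored poset, to an $n$-element chain colored from top to bottom by $c_1,c_2,\dots,c_n$, where the Dynkin diagram is the simply laced path $c_1\sim c_2\sim\cdots\sim c_n$ (with all non-consecutive pairs distant), for some $n\ge1$.
   Context: A Dynkin diagram $\Gamma$: finite set of colors with integers $\theta_{ab}$, $\theta_{aa}=2$, $\theta_{ab}\le0$ ($a\ne b$), $\theta_{ab}=0\iff\theta_{ba}=0$; $a\sim b$ if $a\ne b$ and $\theta_{ab}<0$; simply laced if all $\theta_{ab}\in\{ -1,0,2\}$. $\Gamma$-colored poset: poset $P$ with surjective $\kappa:P\to\Gamma$; isomorphism: poset isomorphism $\pi$ and $\theta$-preserving bijection $\gamma$ of diagrams with $\kappa_2\pi=\gamma\kappa_1$. Consecutive elements of color $a$: $x<y$ of color $a$, no color-$a$ element in $(x,y)$. $U(x,P)=\{y>x:\kappa(y)\sim\kappa(x)\}$, $L(x,P)=\{y<x:\kappa(y)\sim\kappa(x)\}$. $P$ is $\Gamma$-colored minuscule if locally finite and: (EC) equal colors comparable; (NA) neighbors (one covers the other) have adjacent colors; (AC) adjacent colors comparable; (ICE2) consecutive $x<y$ of color $a$ satisfy $\sum_{z\in(x,y)}-\theta_{\kappa(z),a}=2$; (UCB1) for maximal $x$ of color $a$, $U(x,P)$ finite and $\sum_{y\in U(x,P)}-\theta_{\kappa(y),a}\le1$; (LCB1) for minimal $x$ of color $a$,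 $L(x,P)$ finite and $\sum_{y\in L(x,P)}-\theta_{\kappa(y),a}\le1$. -}

module Defs where

open import Data.Nat as ℕ using (ℕ; zero; suc)
open import Data.Fin as Fin using (Fin; toℕ)
open import Data.Fin.Properties as FinP using ()
open import Data.Integer as ℤ using (ℤ; +_; -_)
open import Data.Bool using (Bool; true; false; if_then_else_)
open import Data.Product using (Σ; ∃; _×_; _,_)
open import Data.Sum using (_⊎_)
open import Data.Empty using (⊥)
open import Relation.Nullary using (¬_; Dec; yes; no; does)
open import Relation.Nullary.Decidable using (_×-dec_; ¬?; _⊎-dec_)
open import Relation.Binary using (IsPartialOrder; Decidable)
open import Relation.Binary.PropositionalEquality using (_≡_; _≢_)
open import Relation.Binary.Construct.Closure.ReflexiveTransitive using (Star)
import Relation.Binary.Construct.Flip.EqAndOrd as Flip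
open import Function using (flip)

sumFin : ∀ {n} → (Fin n → ℤ) → ℤ
sumFin {zero}  f = + 0
sumFin {suc n} f = f Fin.zero ℤ.+ sumFin (λ i → f (Fin.suc i))

sumWhere : ∀ {n} {P : Fin n → Set} → (∀ z → Dec (P z)) → (Fin n → ℤ) → ℤ
sumWhere P? f = sumFin (λ z → if does (P? z) then f z else + 0)

record DynkinData : Set where
  field
    m : ℕ
    θ : Fin m → Fin m → ℤ
open DynkinData public

record IsDynkin (Γ : DynkinData) : Set where
  field
    diag    : ∀ a → θ Γ a a ≡ + 2
    offdiag : ∀ a b → a ≢ b → θ Γ a b ℤ.≤ + 0
    zeroSym : ∀ a b → θ Γ a b ≡ + 0 → θ Γ b a ≡ + 0

Adj : (Γ : DynkinData) → Fin (m Γ) → Fin (m Γ) → Set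
Adj Γ a b = a ≢ b × θ Γ a b ℤ.< + 0

adj? : (Γ : DynkinData) → ∀ a b → Dec (Adj Γ a b)
adj? Γ a b = ¬? (a FinP.≟ b) ×-dec (θ Γ a b ℤ.<? + 0)

SimplyLaced : DynkinData → Set
SimplyLaced Γ = ∀ a b → (θ Γ a b ≡ - (+ 1)) ⊎ ((θ Γ a b ≡ + 0) ⊎ (θ Γ a b ≡ + 2))

record ColoredPoset (Γ : DynkinData) : Set₁ where
  field
    n              : ℕ
    _≤_            : Fin n → Fin n → Set
    isPartialOrder : IsPartialOrder _≡_ _≤_
    _≤?_           : Decidable _≤_
    κ              : Fin n → Fin (m Γ)
    κ-surj         : ∀ a → ∃ λ x → κ x ≡ a

  _<_ : Fin n → Fin n → Set
  x < y = x ≤ y × x ≢ y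

  _<?_ : Decidable _<_
  x <? y = (x ≤? y) ×-dec ¬? (x FinP.≟ y)

  Comparable : Fin n → Fin n → Set
  Comparable x y = x ≤ y ⊎ y ≤ x

  _⋖_ : Fin n → Fin n → Set
  x ⋖ y = x < y × (∀ z → ¬ (x < z × z < y))

  inOpen? : ∀ x y z → Dec (x < z × z < y)
  inOpen? x y z = (x <? z) ×-dec (z <? y)

  inU? : ∀ x z → Dec (x < z × Adj Γ (κ z) (κ x))
  inU? x z = (x <? z) ×-dec adj? Γ (κ z) (κ x)

  inL? : ∀ x z → Dec (z < x × Adj Γ (κ z) (κ x))
  inL? x z = (z <? x) ×-dec adj? Γ (κ z) (κ x)

open ColoredPoset public

-- Γ-colored minuscule (local finiteness and finiteness of U, L are
-- automatic since the carrier is finite)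

record IsMinuscule {Γ : DynkinData} (P : ColoredPoset Γ) : Set where
  open ColoredPoset P using () renaming (_≤_ to _≤P_; _<_ to _<P_; _⋖_ to _⋖P_)
  field
    EC   : ∀ x y → κ P x ≡ κ P y → Comparable P x y
    NA   : ∀ x y → x ⋖P y → Adj Γ (κ P x) (κ P y)
    AC   : ∀ x y → Adj Γ (κ P x) (κ P y) → Comparable P x y
    ICE2 : ∀ a x y → κ P x ≡ a → κ P y ≡ a → x <P y →
           (∀ z → x <P z → z <P y → κ P z ≢ a) →
           sumWhere (inOpen? P x y) (λ z → - θ Γ (κ P z) a) ≡ + 2
    UCB1 : ∀ a x → κ P x ≡ a → (∀ y → x <P y → κ P y ≢ a) →
           sumWhere (inU? P x) (λ y → - θ Γ (κ P y) a) ℤ.≤ + 1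
    LCB1 : ∀ a x → κ P x ≡ a → (∀ y → y <P x → κ P y ≢ a) →
           sumWhere (inL? P x) (λ y → - θ Γ (κ P y) a) ℤ.≤ + 1

Connected : {Γ : DynkinData} → ColoredPoset Γ → Set
Connected P = Fin (n P) × (∀ x y → Star (Comparable P) x y)

IsChain : {Γ : DynkinData} → ColoredPoset Γ → Set
IsChain P = ∀ x y → Comparable P x y

record ColoredIso {Γ₁ Γ₂ : DynkinData} (P₁ : ColoredPoset Γ₁) (P₂ : ColoredPoset Γ₂) : Set where
  field
    π       : Fin (n P₁) → Fin (n P₂)
    π⁻¹     : Fin (n P₂) → Fin (n P₁)
    π-invˡ  : ∀ x → π⁻¹ (π x) ≡ x
    π-invʳ  : ∀ y → π (π⁻¹ y) ≡ y
    π-mono  : ∀ x y → _≤_ P₁ x y → _≤_ P₂ (π x) (π y)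
    π-refl  : ∀ x y → _≤_ P₂ (π x) (π y) → _≤_ P₁ x y
    γ       : Fin (m Γ₁) → Fin (m Γ₂)
    γ⁻¹     : Fin (m Γ₂) → Fin (m Γ₁)
    γ-invˡ  : ∀ a → γ⁻¹ (γ a) ≡ a
    γ-invʳ  : ∀ b → γ (γ⁻¹ b) ≡ b
    γ-θ     : ∀ a b → θ Γ₂ (γ a) (γ b) ≡ θ Γ₁ a b
    κ-comm  : ∀ x → κ P₂ (π x) ≡ γ (κ P₁ x)

-- Type A standard: Dynkin path c₁ ∼ c₂ ∼ ⋯ ∼ cₙ (colors Fin n, cᵢ = i-1),
-- chain on Fin n with index 0 the top, element i colored cᵢ₊₁

θA : ∀ k → Fin k → Fin k → ℤ
θA k i j with i FinP.≟ j
... | yes _ = + 2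
... | no _ with suc (toℕ i) ℕ.≟ toℕ j ⊎-dec suc (toℕ j) ℕ.≟ toℕ i
...   | yes _ = - (+ 1)
...   | no _  = + 0

DynkinA : ℕ → DynkinData
DynkinA k = record { m = k ; θ = θA k }

StdChainA : (k : ℕ) → ColoredPoset (DynkinA k)
StdChainA k = record
  { n = k
  ; _≤_ = flip Fin._≤_
  ; isPartialOrder = Flip.isPartialOrder FinP.≤-isPartialOrder
  ; _≤?_ = flip FinP._≤?_
  ; κ = λ i → i
  ; κ-surj = λ a → a , _≡_.refl
  }

TypeAStandard : {Γ : DynkinData} → ColoredPoset Γ → Set
TypeAStandard P = Σ ℕ λ k → (1 ℕ.≤ k) × ColoredIso P (StdChainA k)

-- Number the chain from the top by rank x, the number of elements strictly above x.
-- By downward induction every element u is the highest of its color: if κ v = κ u for some v > u,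
-- the element d covering u has a color adjacent to κ u = κ v, so (UCB1) at d forces v to cover d,
-- and then (u, v) = {d} contributes 1 to the sum that (ICE2) requires to be 2.
-- Once colors are distinct, (UCB1) at y shows that any element above y of adjacent color covers y,
-- and (NA) gives the converse: κ x ∼ κ y exactly when the ranks of x and y are consecutive,
-- which is the type A Cartan matrix read in rank coordinates.
module Submission where

open import Defs
open import Data.Nat as ℕ using (ℕ; zero; suc; z≤n; s≤s)
import Data.Nat.Properties as ℕP
open import Data.Nat.Induction using (<-wellFounded)
open import Data.Fin as Fin using (Fin; toℕ)
import Data.Fin.Properties as FinP
open import Data.Fin.Subset using (Subset; _∈_; ∣_∣)
open import Data.Fin.Subset.Properties using (∈⊤; ∣⊤∣≡n; p⊆q⇒∣p∣≤∣q∣; p⊂q⇒∣p∣<∣q∣)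
open import Data.Vec using (tabulate)
open import Data.Vec.Properties using (lookup∘tabulate; lookup⇒[]=; []=⇒lookup)
open import Data.Integer as ℤ using (ℤ; +_; -_)
import Data.Integer.Properties as ℤP
open import Data.Bool using (true; if_then_else_)
open import Data.Product using (∃; _,_; proj₁; proj₂)
open import Data.Sum using (_⊎_; inj₁; inj₂)
open import Data.Empty using (⊥-elim)
open import Function using (_∘_)
open import Induction.WellFounded using (module All)
open import Relation.Nullary using (¬_; Dec; yes; no; does)
open import Relation.Nullary.Decidable using (dec-true; _⊎-dec_)
open import Relation.Binary using (IsPartialOrder; IsStrictTotalOrder; tri<; tri≈; tri>)
import Relation.Binary.Construct.NonStrictToStrict as NonStrictToStrict
import Relation.Binary.Construct.On as On
open import Relation.Binary.PropositionalEquality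
  using (_≡_; _≢_; refl; sym; trans; cong; cong₂; subst; subst₂)

sumFin-≡0 : ∀ {n} (f : Fin n → ℤ) → (∀ z → f z ≡ + 0) → sumFin f ≡ + 0
sumFin-≡0 {zero}  f f≡0 = refl
sumFin-≡0 {suc n} f f≡0 = cong₂ ℤ._+_ (f≡0 Fin.zero) (sumFin-≡0 (f ∘ Fin.suc) (f≡0 ∘ Fin.suc))

sumFin-single : ∀ {n} (f : Fin n → ℤ) (d : Fin n) → (∀ z → z ≢ d → f z ≡ + 0) → sumFin f ≡ f d
sumFin-single {suc n} f Fin.zero f≡0 =
  trans (cong (ℤ._+_ (f Fin.zero)) (sumFin-≡0 (f ∘ Fin.suc) (λ z → f≡0 (Fin.suc z) (λ ()))))
        (ℤP.+-identityʳ (f Fin.zero))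
sumFin-single {suc n} f (Fin.suc d) f≡0 =
  trans (cong (ℤ._+ sumFin (f ∘ Fin.suc)) (f≡0 Fin.zero (λ ())))
        (trans (ℤP.+-identityˡ _)
               (sumFin-single (f ∘ Fin.suc) d (λ z z≢d → f≡0 (Fin.suc z) (z≢d ∘ FinP.suc-injective))))

sumFin-nonneg : ∀ {n} (f : Fin n → ℤ) → (∀ z → + 0 ℤ.≤ f z) → + 0 ℤ.≤ sumFin f
sumFin-nonneg {zero}  f f≥0 = ℤP.≤-refl
sumFin-nonneg {suc n} f f≥0 = ℤP.+-mono-≤ (f≥0 Fin.zero) (sumFin-nonneg (f ∘ Fin.suc) (f≥0 ∘ Fin.suc))

sumFin-≥-term : ∀ {n} (f : Fin n → ℤ) → (∀ z → + 0 ℤ.≤ f z) → ∀ w → f w ℤ.≤ sumFin f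
sumFin-≥-term {suc n} f f≥0 Fin.zero =
  subst (ℤ._≤ sumFin f) (ℤP.+-identityʳ (f Fin.zero))
        (ℤP.+-monoʳ-≤ (f Fin.zero) (sumFin-nonneg (f ∘ Fin.suc) (f≥0 ∘ Fin.suc)))
sumFin-≥-term {suc n} f f≥0 (Fin.suc w) =
  subst (ℤ._≤ sumFin f) (ℤP.+-identityˡ (f (Fin.suc w)))
        (ℤP.+-mono-≤ (f≥0 Fin.zero) (sumFin-≥-term (f ∘ Fin.suc) (f≥0 ∘ Fin.suc) w))

sumFin-≥-pair : ∀ {n} (f : Fin n → ℤ) → (∀ z → + 0 ℤ.≤ f z) →
                ∀ x w → x ≢ w → f x ℤ.+ f w ℤ.≤ sumFin f
sumFin-≥-pair {suc n} f f≥0 Fin.zero Fin.zero x≢w = ⊥-elim (x≢w refl)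
sumFin-≥-pair {suc n} f f≥0 Fin.zero (Fin.suc w) _ =
  ℤP.+-monoʳ-≤ (f Fin.zero) (sumFin-≥-term (f ∘ Fin.suc) (f≥0 ∘ Fin.suc) w)
sumFin-≥-pair {suc n} f f≥0 (Fin.suc x) Fin.zero _ =
  subst (ℤ._≤ sumFin f) (ℤP.+-comm (f Fin.zero) (f (Fin.suc x)))
        (ℤP.+-monoʳ-≤ (f Fin.zero) (sumFin-≥-term (f ∘ Fin.suc) (f≥0 ∘ Fin.suc) x))
sumFin-≥-pair {suc n} f f≥0 (Fin.suc x) (Fin.suc w) x≢w =
  subst (ℤ._≤ sumFin f) (ℤP.+-identityˡ _)
        (ℤP.+-mono-≤ (f≥0 Fin.zero) (sumFin-≥-pair (f ∘ Fin.suc) (f≥0 ∘ Fin.suc) x w (x≢w ∘ cong Fin.suc)))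

module _ {n} {Q : Fin n → Set} (Q? : ∀ z → Dec (Q z)) (F : Fin n → ℤ) where

  private
    restrict-∈ : ∀ {z} → Q z → (if does (Q? z) then F z else + 0) ≡ F z
    restrict-∈ {z} q = cong (if_then F z else + 0) (dec-true (Q? z) q)

  sumWhere-single : ∀ d → Q d → (∀ z → Q z → z ≡ d) → sumWhere Q? F ≡ F d
  sumWhere-single d q unique = trans (sumFin-single _ d outside) (restrict-∈ q)
    where
    outside : ∀ z → z ≢ d → (if does (Q? z) then F z else + 0) ≡ + 0
    outside z z≢d with Q? z
    ... | yes qz = ⊥-elim (z≢d (unique z qz))
    ... | no _   = refl

  sumWhere-≥2 : (∀ z → Q z → F z ≡ + 1) → ∀ x w → x ≢ w → Q x → Q w → + 2 ℤ.≤ sumWhere Q? F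
  sumWhere-≥2 F≡1 x w x≢w qx qw =
    subst (ℤ._≤ sumWhere Q? F) (cong₂ ℤ._+_ (trans (restrict-∈ qx) (F≡1 x qx)) (trans (restrict-∈ qw) (F≡1 w qw)))
          (sumFin-≥-pair _ nonneg x w x≢w)
    where
    nonneg : ∀ z → + 0 ℤ.≤ (if does (Q? z) then F z else + 0)
    nonneg z with Q? z
    ... | yes qz = subst (+ 0 ℤ.≤_) (sym (F≡1 z qz)) (ℤ.+≤+ z≤n)
    ... | no _   = ℤP.≤-refl

module _ {Γ : DynkinData} (isDynkin : IsDynkin Γ) where
  open IsDynkin isDynkin

  Adj-sym : ∀ {a b} → Adj Γ a b → Adj Γ b a
  Adj-sym {a} {b} (a≢b , θ<0) =
    a≢b ∘ sym , ℤP.≤∧≢⇒< (offdiag b a (a≢b ∘ sym)) (λ θba≡0 → ℤP.<-irrefl (zeroSym b a θba≡0) θ<0)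

  module _ (simplyLaced : SimplyLaced Γ) where

    Adj⇒θ≡-1 : ∀ {a b} → Adj Γ a b → θ Γ a b ≡ - (+ 1)
    Adj⇒θ≡-1 {a} {b} (_ , θ<0) with simplyLaced a b
    ... | inj₁ θ≡-1        = θ≡-1
    ... | inj₂ (inj₁ θ≡0) = ⊥-elim (ℤP.<-irrefl θ≡0 θ<0)
    ... | inj₂ (inj₂ θ≡2) = ⊥-elim (ℤP.<-asym θ<0 (subst (+ 0 ℤ.<_) (sym θ≡2) (ℤ.+<+ (s≤s z≤n))))

    Adj⇒-θ≡1 : ∀ {a b} → Adj Γ a b → - θ Γ a b ≡ + 1
    Adj⇒-θ≡1 adj = cong -_ (Adj⇒θ≡-1 adj)

    ¬Adj⇒θ≡0 : ∀ {a b} → a ≢ b → ¬ Adj Γ a b → θ Γ a b ≡ + 0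
    ¬Adj⇒θ≡0 {a} {b} a≢b ¬adj with simplyLaced a b
    ... | inj₁ θ≡-1        = ⊥-elim (¬adj (a≢b , subst (ℤ._< + 0) (sym θ≡-1) ℤ.-<+))
    ... | inj₂ (inj₁ θ≡0) = θ≡0
    ... | inj₂ (inj₂ θ≡2) = ⊥-elim (ℤP.<⇒≱ (ℤ.+<+ (s≤s z≤n)) (subst (ℤ._≤ + 0) θ≡2 (offdiag a b a≢b)))

Consecutive : ℕ → ℕ → Set
Consecutive i j = suc i ≡ j ⊎ suc j ≡ i

consecutive? : ∀ i j → Dec (Consecutive i j)
consecutive? i j = suc i ℕ.≟ j ⊎-dec suc j ℕ.≟ i

¬Consecutive-refl : ∀ i → ¬ Consecutive i i
¬Consecutive-refl i (inj₁ 1+i≡i) = ℕP.1+n≢n 1+i≡i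
¬Consecutive-refl i (inj₂ 1+i≡i) = ℕP.1+n≢n 1+i≡i

θA-diag : ∀ k (i : Fin k) → θA k i i ≡ + 2
θA-diag k i with i FinP.≟ i
... | yes _   = refl
... | no i≢i = ⊥-elim (i≢i refl)

θA-consecutive : ∀ k (i j : Fin k) → Consecutive (toℕ i) (toℕ j) → θA k i j ≡ - (+ 1)
θA-consecutive k i j c with i FinP.≟ j
... | yes refl = ⊥-elim (¬Consecutive-refl (toℕ i) c)
... | no _ with consecutive? (toℕ i) (toℕ j)
...   | yes _  = refl
...   | no ¬c = ⊥-elim (¬c c)

θA-distant : ∀ k (i j : Fin k) → i ≢ j → ¬ Consecutive (toℕ i) (toℕ j) → θA k i j ≡ + 0
θA-distant k i j i≢j ¬c with i FinP.≟ j
... | yes i≡j = ⊥-elim (i≢j i≡j)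
... | no _ with consecutive? (toℕ i) (toℕ j)
...   | yes c = ⊥-elim (¬c c)
...   | no _  = refl

Fin-injective⇒surjective : ∀ {n} (f : Fin n → Fin n) → (∀ {x y} → f x ≡ f y → x ≡ y) →
                           ∀ y → ∃ λ x → f x ≡ y
Fin-injective⇒surjective {suc n} f f-inj y with FinP.any? (λ x → f x FinP.≟ y)
... | yes hit = hit
... | no miss = ⊥-elim (ℕP.1+n≰n (FinP.injective⇒≤ (f-inj ∘ FinP.punchOut-injective (y≢f _) (y≢f _))))
  where
  y≢f : ∀ x → y ≢ f x
  y≢f x y≡fx = miss (x , sym y≡fx)

does≡true⇒ : ∀ {A : Set} (a? : Dec A) → does a? ≡ true → A
does≡true⇒ (yes a) _  = a
does≡true⇒ (no _)  ()

chain⇒isStrictTotalOrder : ∀ {Γ} (P : ColoredPoset Γ) → IsChain P → IsStrictTotalOrder _≡_ (_<_ P)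
chain⇒isStrictTotalOrder P isChain = NonStrictToStrict.<-isStrictTotalOrder₁ _≡_ (_≤_ P) FinP._≟_
  record { isPartialOrder = isPartialOrder P ; total = isChain }

-- rank identifies a finite chain with Fin n, listed from the top.
module FiniteChain {Γ : DynkinData} (P : ColoredPoset Γ) (isChain : IsChain P) where
  open ColoredPoset P using ()
    renaming (n to N; _≤_ to _≤ₚ_; _<_ to _<ₚ_; _<?_ to _<ₚ?_; _⋖_ to _⋖ₚ_; isPartialOrder to ≤ₚ-isPartialOrder)
  open IsStrictTotalOrder (chain⇒isStrictTotalOrder P isChain) public
    using (compare) renaming (trans to <ₚ-trans; irrefl to <ₚ-irrefl)

  upSet : Fin N → Subset N
  upSet x = tabulate (λ z → does (x <ₚ? z))

  <⇒∈upSet : ∀ {x z} → x <ₚ z → z ∈ upSet x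
  <⇒∈upSet {x} {z} x<z = lookup⇒[]= z (upSet x) (trans (lookup∘tabulate _ z) (dec-true (x <ₚ? z) x<z))

  ∈upSet⇒< : ∀ {x z} → z ∈ upSet x → x <ₚ z
  ∈upSet⇒< {x} {z} z∈ = does≡true⇒ (x <ₚ? z) (trans (sym (lookup∘tabulate _ z)) ([]=⇒lookup z∈))

  ∉upSet : ∀ x → ¬ x ∈ upSet x
  ∉upSet x = <ₚ-irrefl refl ∘ ∈upSet⇒<

  rank : Fin N → ℕ
  rank x = ∣ upSet x ∣

  rank-antitone : ∀ {x y} → x ≤ₚ y → rank y ℕ.≤ rank x
  rank-antitone x≤y = p⊆q⇒∣p∣≤∣q∣ (<⇒∈upSet ∘ ≤-<-trans x≤y ∘ ∈upSet⇒<)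
    where
    open IsPartialOrder ≤ₚ-isPartialOrder using (antisym; ≲-respˡ-≈) renaming (trans to ≤-trans)
    ≤-<-trans : ∀ {x y z} → x ≤ₚ y → y <ₚ z → x <ₚ z
    ≤-<-trans = NonStrictToStrict.≤-<-trans _≡_ _≤ₚ_ ≤-trans antisym ≲-respˡ-≈

  rank-strictlyAntitone : ∀ {x y} → x <ₚ y → rank y ℕ.< rank x
  rank-strictlyAntitone {x} {y} x<y =
    p⊂q⇒∣p∣<∣q∣ ((<⇒∈upSet ∘ <ₚ-trans x<y ∘ ∈upSet⇒<) , y , <⇒∈upSet x<y , ∉upSet y)

  rank<N : ∀ x → rank x ℕ.< N
  rank<N x = subst (rank x ℕ.<_) (∣⊤∣≡n N) (p⊂q⇒∣p∣<∣q∣ ((λ _ → ∈⊤) , x , ∈⊤ , ∉upSet x))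

  rank>⇒< : ∀ {x y} → rank y ℕ.< rank x → x <ₚ y
  rank>⇒< {x} {y} ry<rx with compare x y
  ... | tri< x<y _ _ = x<y
  ... | tri≈ _ refl _ = ⊥-elim (ℕP.<-irrefl refl ry<rx)
  ... | tri> _ _ y<x = ⊥-elim (ℕP.<-asym ry<rx (rank-strictlyAntitone y<x))

  rank-injective : ∀ {x y} → rank x ≡ rank y → x ≡ y
  rank-injective {x} {y} rx≡ry with compare x y
  ... | tri< x<y _ _ = ⊥-elim (ℕP.<-irrefl (sym rx≡ry) (rank-strictlyAntitone x<y))
  ... | tri≈ _ x≡y _ = x≡y
  ... | tri> _ _ y<x = ⊥-elim (ℕP.<-irrefl rx≡ry (rank-strictlyAntitone y<x))

  toFin : Fin N → Fin N
  toFin x = Fin.fromℕ< (rank<N x)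

  toℕ-toFin : ∀ x → toℕ (toFin x) ≡ rank x
  toℕ-toFin x = FinP.toℕ-fromℕ< (rank<N x)

  toFin-injective : ∀ {x y} → toFin x ≡ toFin y → x ≡ y
  toFin-injective {x} {y} eq = rank-injective (trans (sym (toℕ-toFin x)) (trans (cong toℕ eq) (toℕ-toFin y)))

  fromFin : Fin N → Fin N
  fromFin i = proj₁ (Fin-injective⇒surjective toFin toFin-injective i)

  toFin∘fromFin : ∀ i → toFin (fromFin i) ≡ i
  toFin∘fromFin i = proj₂ (Fin-injective⇒surjective toFin toFin-injective i)

  fromFin∘toFin : ∀ x → fromFin (toFin x) ≡ x
  fromFin∘toFin x = toFin-injective (toFin∘fromFin (toFin x))

  rank-surjective : ∀ {m} → m ℕ.< N → ∃ λ x → rank x ≡ m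
  rank-surjective m<N =
    fromFin i , trans (sym (toℕ-toFin (fromFin i))) (trans (cong toℕ (toFin∘fromFin i)) (FinP.toℕ-fromℕ< m<N))
    where i = Fin.fromℕ< m<N

  rank⇒⋖ : ∀ {u d} → suc (rank d) ≡ rank u → u ⋖ₚ d
  rank⇒⋖ {u} {d} 1+rd≡ru =
    rank>⇒< (ℕP.≤-reflexive 1+rd≡ru) ,
    λ z (u<z , z<d) → ℕP.<⇒≱ (rank-strictlyAntitone z<d)
                              (ℕP.≤-pred (subst (rank z ℕ.<_) (sym 1+rd≡ru) (rank-strictlyAntitone u<z)))

  ⋖⇒rank : ∀ {u d} → u ⋖ₚ d → suc (rank d) ≡ rank u
  ⋖⇒rank {u} {d} (u<d , nothing-between) with rank-surjective (ℕP.≤-<-trans (rank-strictlyAntitone u<d) (rank<N u))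
  ... | z , rz≡ = ℕP.≤-antisym (rank-strictlyAntitone u<d) (subst (rank u ℕ.≤_) rz≡ (ℕP.≮⇒≥ z-not-below-u))
    where
    z-not-below-u : ¬ rank z ℕ.< rank u
    z-not-below-u rz<ru =
      nothing-between z (rank>⇒< rz<ru , rank>⇒< (subst (rank d ℕ.<_) (sym rz≡) (ℕP.n<1+n (rank d))))

  ∃-cover : ∀ {x y} → x <ₚ y → ∃ (x ⋖ₚ_)
  ∃-cover {x} {y} x<y with rank x in rx≡ | rank-strictlyAntitone x<y | rank<N x
  ... | suc m | _ | m<N with rank-surjective (ℕP.<-trans (ℕP.n<1+n m) m<N)
  ...   | d , rd≡m = d , rank⇒⋖ (trans (cong suc rd≡m) (sym rx≡))

  between-covers : ∀ {u d v z} → u ⋖ₚ d → d ⋖ₚ v → u <ₚ z → z <ₚ v → z ≡ d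
  between-covers {d = d} {z = z} (_ , u⋖d-empty) (_ , d⋖v-empty) u<z z<v with compare z d
  ... | tri< z<d _ _ = ⊥-elim (u⋖d-empty z (u<z , z<d))
  ... | tri≈ _ z≡d _ = z≡d
  ... | tri> _ _ d<z = ⊥-elim (d⋖v-empty z (d<z , z<v))

module MinusculeChain {Γ : DynkinData} (isDynkin : IsDynkin Γ) (simplyLaced : SimplyLaced Γ)
                      (P : ColoredPoset Γ) (isMinuscule : IsMinuscule P) (isChain : IsChain P) where
  open ColoredPoset P using () renaming (n to N; _<_ to _<ₚ_; _⋖_ to _⋖ₚ_)
  open IsDynkin isDynkin using (diag)
  open IsMinuscule isMinuscule
  open FiniteChain P isChain

  TopOfColor : Fin N → Set
  TopOfColor x = ∀ y → x <ₚ y → κ P y ≢ κ P x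

  -- By (UCB1) the set U(y) has at most one element, and the element covering y is one.
  adjacent-above-top⇒⋖ : ∀ {x y} → TopOfColor y → y <ₚ x → Adj Γ (κ P x) (κ P y) → y ⋖ₚ x
  adjacent-above-top⇒⋖ {x} {y} top y<x adj with ∃-cover y<x
  ... | w , y⋖w with x FinP.≟ w
  ...   | yes refl = y⋖w
  ...   | no x≢w  = ⊥-elim (2≰1 (ℤP.≤-trans two-in-U (UCB1 (κ P y) y refl top)))
    where
    2≰1 : ¬ (+ 2 ℤ.≤ + 1)
    2≰1 (ℤ.+≤+ (s≤s ()))
    two-in-U : + 2 ℤ.≤ sumWhere (inU? P y) (λ z → - θ Γ (κ P z) (κ P y))
    two-in-U = sumWhere-≥2 (inU? P y) _ (λ z → Adj⇒-θ≡1 isDynkin simplyLaced ∘ proj₂) x w x≢w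
                 (y<x , adj) (proj₁ y⋖w , Adj-sym isDynkin (NA y w y⋖w))

  topOfColor : ∀ u → TopOfColor u
  topOfColor = All.wfRec (On.wellFounded rank <-wellFounded) _ TopOfColor step
    where
    step : ∀ u → (∀ {z} → rank z ℕ.< rank u → TopOfColor z) → TopOfColor u
    step u ih v u<v κv≡κu with ∃-cover u<v
    ... | d , u⋖d with compare d v
    ...   | tri≈ _ refl _ = proj₁ (NA u d u⋖d) (sym κv≡κu)
    ...   | tri> _ _ v<d  = proj₂ u⋖d v (u<v , v<d)
    ...   | tri< d<v _ _  = 1≢2 (trans (sym sum≡1) sum≡2)
      where
      1≢2 : + 1 ≢ + 2
      1≢2 ()
      d⋖v : d ⋖ₚ v
      d⋖v = adjacent-above-top⇒⋖ (ih (rank-strictlyAntitone (proj₁ u⋖d))) d<v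
              (subst (λ c → Adj Γ c (κ P d)) (sym κv≡κu) (NA u d u⋖d))
      no-color-between : ∀ z → u <ₚ z → z <ₚ v → κ P z ≢ κ P v
      no-color-between z u<z z<v κz≡κv = ih (rank-strictlyAntitone u<z) v z<v (sym κz≡κv)
      sum≡2 : sumWhere (inOpen? P u v) (λ z → - θ Γ (κ P z) (κ P v)) ≡ + 2
      sum≡2 = ICE2 (κ P v) u v (sym κv≡κu) refl u<v no-color-between
      sum≡1 : sumWhere (inOpen? P u v) (λ z → - θ Γ (κ P z) (κ P v)) ≡ + 1
      sum≡1 = trans (sumWhere-single (inOpen? P u v) _ d (proj₁ u⋖d , d<v)
                                     (λ z (u<z , z<v) → between-covers u⋖d d⋖v u<z z<v))
                    (Adj⇒-θ≡1 isDynkin simplyLaced (NA d v d⋖v))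

  κ-injective : ∀ {x y} → κ P x ≡ κ P y → x ≡ y
  κ-injective {x} {y} κx≡κy with compare x y
  ... | tri< x<y _ _ = ⊥-elim (topOfColor x y x<y (sym κx≡κy))
  ... | tri≈ _ x≡y _ = x≡y
  ... | tri> _ _ y<x = ⊥-elim (topOfColor y x y<x κx≡κy)

  Adj⇒consecutive : ∀ {x y} → Adj Γ (κ P x) (κ P y) → Consecutive (rank x) (rank y)
  Adj⇒consecutive {x} {y} adj with compare x y
  ... | tri< x<y _ _ = inj₂ (⋖⇒rank (adjacent-above-top⇒⋖ (topOfColor x) x<y (Adj-sym isDynkin adj)))
  ... | tri≈ _ refl _ = ⊥-elim (proj₁ adj refl)
  ... | tri> _ _ y<x = inj₁ (⋖⇒rank (adjacent-above-top⇒⋖ (topOfColor y) y<x adj))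

  consecutive⇒Adj : ∀ {x y} → Consecutive (rank x) (rank y) → Adj Γ (κ P x) (κ P y)
  consecutive⇒Adj {x} {y} (inj₁ 1+rx≡ry) = Adj-sym isDynkin (NA y x (rank⇒⋖ 1+rx≡ry))
  consecutive⇒Adj {x} {y} (inj₂ 1+ry≡rx) = NA x y (rank⇒⋖ 1+ry≡rx)

  θ≡θA-toFin : ∀ x y → θ Γ (κ P x) (κ P y) ≡ θA N (toFin x) (toFin y)
  θ≡θA-toFin x y with x FinP.≟ y
  ... | yes refl = trans (diag (κ P x)) (sym (θA-diag N (toFin x)))
  ... | no x≢y with consecutive? (rank x) (rank y)
  ...   | yes c  = trans (Adj⇒θ≡-1 isDynkin simplyLaced (consecutive⇒Adj c))
                         (sym (θA-consecutive N _ _ (subst₂ Consecutive (sym (toℕ-toFin x)) (sym (toℕ-toFin y)) c)))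
  ...   | no ¬c = trans (¬Adj⇒θ≡0 isDynkin simplyLaced (x≢y ∘ κ-injective) (¬c ∘ Adj⇒consecutive))
                         (sym (θA-distant N _ _ (x≢y ∘ toFin-injective)
                                           (¬c ∘ subst₂ Consecutive (toℕ-toFin x) (toℕ-toFin y))))

  κ⁻¹ : Fin (m Γ) → Fin N
  κ⁻¹ a = proj₁ (κ-surj P a)

  κ∘κ⁻¹ : ∀ a → κ P (κ⁻¹ a) ≡ a
  κ∘κ⁻¹ a = proj₂ (κ-surj P a)

  κ⁻¹∘κ : ∀ x → κ⁻¹ (κ P x) ≡ x
  κ⁻¹∘κ x = κ-injective (κ∘κ⁻¹ (κ P x))

  toFin-monotone : ∀ x y → _≤_ P x y → toFin y Fin.≤ toFin x
  toFin-monotone x y x≤y = subst₂ ℕ._≤_ (sym (toℕ-toFin y)) (sym (toℕ-toFin x)) (rank-antitone x≤y)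

  toFin-reflects : ∀ x y → toFin y Fin.≤ toFin x → _≤_ P x y
  toFin-reflects x y le with compare x y
  ... | tri< x<y _ _ = proj₁ x<y
  ... | tri≈ _ refl _ = IsPartialOrder.refl (isPartialOrder P)
  ... | tri> _ _ y<x = ⊥-elim (ℕP.<⇒≱ (rank-strictlyAntitone y<x)
                                       (subst₂ ℕ._≤_ (toℕ-toFin y) (toℕ-toFin x) le))

  ≅StdChainA : ColoredIso P (StdChainA N)
  ≅StdChainA = record
    { π      = toFin
    ; π⁻¹    = fromFin
    ; π-invˡ = fromFin∘toFin
    ; π-invʳ = toFin∘fromFin
    ; π-mono = toFin-monotone
    ; π-refl = toFin-reflects
    ; γ      = toFin ∘ κ⁻¹
    ; γ⁻¹    = κ P ∘ fromFin
    ; γ-invˡ = λ a → trans (cong (κ P) (fromFin∘toFin (κ⁻¹ a))) (κ∘κ⁻¹ a)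
    ; γ-invʳ = λ i → trans (cong toFin (κ⁻¹∘κ (fromFin i))) (toFin∘fromFin i)
    ; γ-θ    = λ a b → trans (sym (θ≡θA-toFin (κ⁻¹ a) (κ⁻¹ b))) (cong₂ (θ Γ) (κ∘κ⁻¹ a) (κ∘κ⁻¹ b))
    ; κ-comm = λ x → cong toFin (sym (κ⁻¹∘κ x))
    }

theorem4p6 : (Γ : DynkinData) → IsDynkin Γ → SimplyLaced Γ →
    (P : ColoredPoset Γ) → IsMinuscule P → Connected P → IsChain P →
    TypeAStandard P
theorem4p6 Γ isDynkin simplyLaced P isMinuscule (x , _) isChain =
  n P , ℕP.≤-<-trans z≤n (FinP.toℕ<n x) , MinusculeChain.≅StdChainA isDynkin simplyLaced P isMinuscule isChain
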